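{- Let $\mathfrak X$ be a homogeneous tree of degree $q+1$ ($q\geq1$). For every integer $k\geq0$, the mean value operator $\mu_k$ satisfies $$\mu_k=\left(\frac{1}{\sqrt q}\right)^k\left[\sqrt q\,\mu_1\,U_{k-1}\!\left(\frac{q+1}{2\sqrt q}\mu_1\right)-U_{k-2}\!\left(\frac{q+1}{2\sqrt q}\mu_1\right)\right].$$
   Context: $\mathfrak X$ is a tree in which every vertex has exactly $q+1$ edges; $d$ is graph distance; $\mathcal F(\mathfrak X)$ is the space of complex-valued functions on its vertices; $S_k(v)=\{w:d(v,w)=k\}$; $\mu_0f=f$ and for $k\geq1$, $\mu_kf(v)=\frac{1}{(q+1)q^{k-1}}\sum_{w\in S_k(v)}f(w)$. $U_n$: Chebyshev polynomials of the second kind, $U_0=1$, $U_1(x)=2x$, $U_n=2xU_{n-1}-U_{n-2}$, with $U_{ -n-1}=-U_{n-1}$ for $n\geq0$ (so $U_{ -1}=0$, $U_{ -2}=-1$); polynomials are applied to the operator $\mu_1$. -}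

module Defs where

open import Level using (Level)
open import Algebra.Bundles using (CommutativeRing)
open import Data.Nat using (ℕ; zero; suc; _∸_; _≡ᵇ_)
import Data.Nat as N
open import Data.Bool using (Bool; true; false; not; _∧_; if_then_else_)
open import Data.Fin using (Fin; _≟_)
open import Data.List using (List; []; _∷_; [_]; length; map; filterᵇ; concatMap; upTo; allFin; foldr)
open import Relation.Nullary.Decidable using (⌊_⌋)

-- Model of the homogeneous tree X of degree q+1: the Cayley graph of the free
-- product of q+1 copies of Z/2. A vertex is a reduced word over the alphabet
-- Fin (suc q) (no two adjacent letters equal), read from the root [] outwards.
-- w is adjacent to a ∷ w ... more precisely: the neighbours of a word w are
-- (w with its last letter removed) and (w extended by any letter different
-- from its last letter).

Word : ℕ → Set
Word q = List (Fin (suc q))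

reduced : ∀ {m} → List (Fin m) → Bool
reduced [] = true
reduced (a ∷ []) = true
reduced (a ∷ b ∷ w) = not ⌊ a ≟ b ⌋ ∧ reduced (b ∷ w)

-- length of the longest common prefix (= length of the common part of the
-- two geodesics from the root)
lcp : ∀ {m} → List (Fin m) → List (Fin m) → ℕ
lcp (a ∷ v) (b ∷ w) = if ⌊ a ≟ b ⌋ then suc (lcp v w) else 0
lcp _ _ = 0

dist : ∀ {m} → List (Fin m) → List (Fin m) → ℕ
dist v w = (length v N.+ length w) ∸ (2 N.* lcp v w)

wordsOfLength : (q : ℕ) → ℕ → List (Word q)
wordsOfLength q zero = [ [] ]
wordsOfLength q (suc n) =
  concatMap (λ w → filterᵇ reduced (map (_∷ w) (allFin (suc q)))) (wordsOfLength q n)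

ball : (q : ℕ) → ℕ → List (Word q)
ball q n = concatMap (wordsOfLength q) (upTo (suc n))

-- the sphere S_k(v) = { w : d(v,w) = k } (it is contained in the ball of
-- radius |v| + k around the root)
sphere : (q : ℕ) → ℕ → Word q → List (Word q)
sphere q k v = filterᵇ (λ w → dist v w ≡ᵇ k) (ball q (length v N.+ k))

module Tree {c ℓ : Level} (R : CommutativeRing c ℓ) where
  open CommutativeRing R

  natR : ℕ → Carrier
  natR zero = 0#
  natR (suc n) = 1# + natR n

  pow : Carrier → ℕ → Carrier
  pow x zero = 1#
  pow x (suc n) = x * pow x n

  sumR : List Carrier → Carrier
  sumR = foldr _+_ 0#

  -- functions on vertices (values on non-reduced words are never used)
  Fn : ℕ → Set c
  Fn q = Word q → Carrier

  Op : ℕ → Set c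
  Op q = Fn q → Fn q

  -- mean value operator μ_k; sInv plays 1/√q and t plays 1/(q+1), so that
  -- t * sInv^(2(k-1)) = 1 / ((q+1) q^(k-1)).
  μ : (q : ℕ) (sInv t : Carrier) → ℕ → Op q
  μ q sInv t zero f = f
  μ q sInv t (suc k) f v =
    (t * pow sInv (2 N.* k)) * sumR (map f (sphere q (suc k) v))

  -- Chebyshev polynomials of the second kind applied to an operator T,
  -- shifted by 2:  chebU T n = U_{n-2}(T), so
  -- chebU T 0 = U_{-2}(T) = -I, chebU T 1 = U_{-1}(T) = 0,
  -- chebU T (n+2) = 2 T (chebU T (n+1)) - chebU T n.
  chebU : ∀ {q} → Op q → ℕ → Op q
  chebU T zero f v = - f v
  chebU T (suc zero) f v = 0#
  chebU T (suc (suc n)) f v =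
    natR 2 * T (chebU T (suc n) f) v - chebU T n f v

  scaleOp : ∀ {q} → Carrier → Op q → Op q
  scaleOp a T f v = a * T f v

{-# OPTIONS --safe #-}
module Submission where

-- The mean value operators satisfy the three-term recurrence
--   (q+1) μ₁ μ_{k+1} = q μ_{k+2} + μ_k      (k ≥ 0).
-- Of the q+1 neighbours of v exactly one is closer to any vertex u ≠ v, so summing f over
-- S_{k+1}(w) for all neighbours w of v counts each point of S_{k+2}(v) once and each point
-- of S_k(v) q times (q+1 times when k = 0). With A = (q+1)/(2√q) μ₁, the Chebyshev relation
-- U_{n+1}(A) = 2A U_n(A) − U_{n-1}(A) and the linearity of μ₁ show that the right-hand side
-- satisfies the same recurrence, and both sides agree for k = 0 and k = 1.

open import Defs
open import Level using (Level)
open import Algebra.Bundles using (CommutativeRing)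
open import Algebra.Definitions using (Congruent₂)
open import Data.Bool using (Bool; true; false; T; not; if_then_else_; T?)
open import Data.Bool.Properties using (if-eta; if-float)
open import Data.Fin as Fin using (Fin; _≟_)
open import Data.List using (List; []; _∷_; [_]; map; filterᵇ; concatMap; length; _++_; allFin; upTo; _∷ʳ_)
open import Data.List.Properties using (map-∘; map-tabulate; upTo-∷ʳ)
open import Data.List.Relation.Unary.All as All using (All; []; _∷_)
open import Data.List.Relation.Unary.All.Properties using (map⁺; concat⁺; applyUpTo⁺₁; all-filter; filter⁺)
open import Data.Nat as ℕ using (ℕ; zero; suc; _≤_; _<_; _≡ᵇ_; _∸_; z≤n; s≤s)
import Data.Nat.Properties as ℕₚ
open import Data.Product using (_×_; _,_; proj₁)
open import Data.Sum using (inj₁; inj₂)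
open import Data.Unit using (tt)
open import Function using (id; _∘_)
open import Relation.Binary.Bundles using (Setoid)
open import Relation.Binary.PropositionalEquality as ≡ using (_≡_; _≢_)
open import Relation.Nullary using (Dec; yes; no; contradiction)
open import Relation.Nullary.Decidable using (⌊_⌋; dec-true; dec-false; toWitnessFalse)

module _ {a ℓ : Level} (S : Setoid a ℓ) where
  open Setoid S

  recurrence-unique : (step : Carrier → Carrier → Carrier) → Congruent₂ _≈_ step →
    (X Y : ℕ → Carrier) →
    (∀ k → X (suc (suc k)) ≈ step (X (suc k)) (X k)) →
    (∀ k → Y (suc (suc k)) ≈ step (Y (suc k)) (Y k)) →
    X 0 ≈ Y 0 → X 1 ≈ Y 1 → ∀ k → X k ≈ Y k
  recurrence-unique step step-cong X Y X-rec Y-rec X₀≈Y₀ X₁≈Y₁ k = proj₁ (agree k)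
    where
    agree : ∀ k → X k ≈ Y k × X (suc k) ≈ Y (suc k)
    agree zero    = X₀≈Y₀ , X₁≈Y₁
    agree (suc k) = let (Xₖ≈Yₖ , Xₖ₊₁≈Yₖ₊₁) = agree k in
      Xₖ₊₁≈Yₖ₊₁ , trans (X-rec k) (trans (step-cong Xₖ₊₁≈Yₖ₊₁ Xₖ≈Yₖ) (sym (Y-rec k)))

≡ᵇ-refl : (m : ℕ) → (m ≡ᵇ m) ≡ true
≡ᵇ-refl m = dec-true (T? (m ≡ᵇ m)) (ℕₚ.≡⇒≡ᵇ m m ≡.refl)

≡ᵇ-false : {m n : ℕ} → m ≢ n → (m ≡ᵇ n) ≡ false
≡ᵇ-false {m} {n} m≢n = dec-false (T? (m ≡ᵇ n)) (m≢n ∘ ℕₚ.≡ᵇ⇒≡ m n)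

-- Distance in the tree

module _ {m : ℕ} where
  open import Data.Nat using (_+_)
  open ≡ using (refl; cong; cong₂)

  ≟-suc : (a b : Fin m) → ⌊ Fin.suc a ≟ Fin.suc b ⌋ ≡ ⌊ a ≟ b ⌋
  ≟-suc a b with a ≟ b
  ... | yes _ = refl
  ... | no _  = refl

  dist-∷ : (a b : Fin m) (x y : List (Fin m)) →
           dist (a ∷ x) (b ∷ y) ≡ (if ⌊ a ≟ b ⌋ then dist x y else suc (length x) + suc (length y))
  dist-∷ a b x y with ⌊ a ≟ b ⌋
  ... | true  = cong₂ _∸_ (ℕₚ.+-suc (length x) (length y)) (ℕₚ.+-suc (lcp x y) (lcp x y + 0))
  ... | false = refl

  dist-∷-≡ : (a : Fin m) (x y : List (Fin m)) → dist (a ∷ x) (a ∷ y) ≡ dist x y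
  dist-∷-≡ a x y with a ≟ a | dist-∷ a a x y
  ... | yes _  | eq = eq
  ... | no a≢a | _  = contradiction refl a≢a

  dist-∷-≢ : {a b : Fin m} (x y : List (Fin m)) → a ≢ b →
             dist (a ∷ x) (b ∷ y) ≡ suc (length x) + suc (length y)
  dist-∷-≢ {a} {b} x y a≢b with a ≟ b | dist-∷ a b x y
  ... | yes a≡b | _  = contradiction a≡b a≢b
  ... | no _    | eq = eq

  dist-[]ʳ : (x : List (Fin m)) → dist x [] ≡ length x
  dist-[]ʳ []      = refl
  dist-[]ʳ (a ∷ x) = cong suc (ℕₚ.+-identityʳ (length x))

  dist-self : (x : List (Fin m)) → dist x x ≡ 0
  dist-self []      = refl
  dist-self (a ∷ x) = ≡.trans (dist-∷-≡ a x x) (dist-self x)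

  dist≡ᵇ0⇒≡ : (x y : List (Fin m)) → (dist x y ≡ᵇ 0) ≡ true → x ≡ y
  -- Splitting on a ≟ b through an argument: `with` would also abstract the copy of
  -- a ≟ b hidden inside dist and unfold it.
  dist≡ᵇ0⇒≡ []      []      _ = refl
  dist≡ᵇ0⇒≡ (a ∷ x) (b ∷ y)   = heads (a ≟ b)
    where
    IsZero : ℕ → Set
    IsZero d = (d ≡ᵇ 0) ≡ true

    heads : Dec (a ≡ b) → IsZero (dist (a ∷ x) (b ∷ y)) → a ∷ x ≡ b ∷ y
    heads (yes refl) d≡0 = cong (a ∷_) (dist≡ᵇ0⇒≡ x y (≡.subst IsZero (dist-∷-≡ a x y) d≡0))
    heads (no a≢b)   d≡0 = contradiction (≡.subst IsZero (dist-∷-≢ x y a≢b) d≡0) λ ()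


  length≤length+dist : (x y : List (Fin m)) → length y ≤ length x + dist x y
  length≤length+dist []      y       = ℕₚ.≤-refl
  length≤length+dist (a ∷ x) []      = z≤n
  length≤length+dist (a ∷ x) (b ∷ y) rewrite dist-∷ a b x y with ⌊ a ≟ b ⌋
  ... | true  = s≤s (length≤length+dist x y)
  ... | false = ℕₚ.≤-trans y≤x+y (ℕₚ.+-monoʳ-≤ (suc (length x)) y≤x+y)
    where
    y≤x+y : suc (length y) ≤ suc (length x) + suc (length y)
    y≤x+y = ℕₚ.m≤n+m (suc (length y)) (suc (length x))

  long⇒dist≢ : (x y : List (Fin m)) {j : ℕ} → length x + j < length y → dist x y ≢ j
  long⇒dist≢ x y long refl = ℕₚ.<-irrefl refl (ℕₚ.<-≤-trans long (length≤length+dist x y))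

  reduced-tail : {a : Fin m} (x : List (Fin m)) → T (reduced (a ∷ x)) → T (reduced x)
  reduced-tail []      _ = tt
  reduced-tail {a} (b ∷ x) r with ⌊ a ≟ b ⌋
  ... | false = r

  reduced-head : {a b : Fin m} (x : List (Fin m)) → T (reduced (a ∷ b ∷ x)) → a ≢ b
  reduced-head {a} {b} x r a≡b with a ≟ b
  ... | no a≢b = a≢b a≡b

  ∷-reduced : {a b : Fin m} (x : List (Fin m)) → a ≢ b → T (reduced (b ∷ x)) → T (reduced (a ∷ b ∷ x))
  ∷-reduced {a} {b} _ a≢b r with a ≟ b
  ... | yes a≡b = a≢b a≡b
  ... | no _    = r

module MeanValues {c ℓ : Level} (R : CommutativeRing c ℓ) where
  open CommutativeRing R
  open Tree R
  open import Algebra.Properties.Ring ring using (-‿distribʳ-*; x[y-z]≈xy-xz)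
  open import Algebra.Properties.AbelianGroup +-abelianGroup
    using (⁻¹-∙-comm; ⁻¹-involutive; ⁻¹-anti-homo-∙; ε⁻¹≈ε; ∙-cancelˡ)
  open import Algebra.Properties.CommutativeSemigroup +-commutativeSemigroup using (interchange)
  open import Algebra.Properties.CommutativeSemigroup *-commutativeSemigroup using (x∙yz≈y∙xz)
  open import Algebra.Solver.Ring.NaturalCoefficients.Default commutativeSemiring
    using (solve; _:=_; _:+_; _:*_)
  open import Relation.Binary.Reasoning.Setoid setoid

  private
    variable
      ℓa ℓb : Level
      A : Set ℓa
      B : Set ℓb

  -‿sub : ∀ x y → - (x - y) ≈ - x + y
  -‿sub x y = trans (⁻¹-anti-homo-∙ x (- y)) (trans (+-congʳ (⁻¹-involutive y)) (+-comm y (- x)))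

  x+y-y≈x : ∀ x y → x + y - y ≈ x
  x+y-y≈x x y = trans (+-assoc x y (- y)) (trans (+-congˡ (-‿inverseʳ y)) (+-identityʳ x))

  x-0≈x : ∀ x → x - 0# ≈ x
  x-0≈x x = trans (+-congˡ ε⁻¹≈ε) (+-identityʳ x)

  pow-2*suc : ∀ x k → pow x (2 ℕ.* suc k) ≡ x * (x * pow x (2 ℕ.* k))
  pow-2*suc x k = ≡.cong (pow x) (ℕₚ.*-suc 2 k)

  natR-suc-* : ∀ n y → natR (suc n) * y ≈ y + natR n * y
  natR-suc-* n y = trans (distribʳ y 1# (natR n)) (+-congʳ (*-identityˡ y))

  -- Finite sums

  infixr 8 [_]·_
  [_]·_ : Bool → Carrier → Carrier
  [ b ]· y = if b then y else 0#

  if-split : ∀ b (x y : Carrier) → (if b then x else y) ≈ [ b ]· x + [ not b ]· y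
  if-split true  x y = sym (+-identityʳ x)
  if-split false x y = sym (+-identityˡ y)

  ∑ : (A → Carrier) → List A → Carrier
  ∑ g xs = sumR (map g xs)

  ∑-congᴬ : {xs : List A} {g h : A → Carrier} → All (λ x → g x ≈ h x) xs → ∑ g xs ≈ ∑ h xs
  ∑-congᴬ []         = refl
  ∑-congᴬ (gx≈hx ∷ e) = +-cong gx≈hx (∑-congᴬ e)

  ∑-cong : (xs : List A) {g h : A → Carrier} → (∀ x → g x ≈ h x) → ∑ g xs ≈ ∑ h xs
  ∑-cong xs g≈h = ∑-congᴬ (All.universal g≈h xs)

  ∑-0 : (xs : List A) → ∑ (λ _ → 0#) xs ≈ 0#
  ∑-0 []       = refl
  ∑-0 (x ∷ xs) = trans (+-identityˡ _) (∑-0 xs)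

  ∑-[]·0 : (p : A → Bool) (xs : List A) → ∑ (λ x → [ p x ]· 0#) xs ≈ 0#
  ∑-[]·0 p xs = trans (∑-cong xs (λ x → reflexive (if-eta (p x)))) (∑-0 xs)

  ∑-map : (g : B → Carrier) (f : A → B) (xs : List A) → ∑ g (map f xs) ≡ ∑ (g ∘ f) xs
  ∑-map g f xs = ≡.cong sumR (≡.sym (map-∘ xs))

  ∑-++ : (g : A → Carrier) (xs ys : List A) → ∑ g (xs ++ ys) ≈ ∑ g xs + ∑ g ys
  ∑-++ g []       ys = sym (+-identityˡ _)
  ∑-++ g (x ∷ xs) ys = trans (+-congˡ (∑-++ g xs ys)) (sym (+-assoc _ _ _))

  ∑-concatMap : (g : B → Carrier) (F : A → List B) (xs : List A) →
                ∑ g (concatMap F xs) ≈ ∑ (λ x → ∑ g (F x)) xs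
  ∑-concatMap g F []       = refl
  ∑-concatMap g F (x ∷ xs) = trans (∑-++ g (F x) (concatMap F xs)) (+-congˡ (∑-concatMap g F xs))

  ∑-filterᵇ : (g : A → Carrier) (p : A → Bool) (xs : List A) →
              ∑ g (filterᵇ p xs) ≈ ∑ (λ x → [ p x ]· g x) xs
  ∑-filterᵇ g p []       = refl
  ∑-filterᵇ g p (x ∷ xs) with p x
  ... | true  = +-congˡ (∑-filterᵇ g p xs)
  ... | false = trans (∑-filterᵇ g p xs) (sym (+-identityˡ _))

  ∑-+ : (g h : A → Carrier) (xs : List A) → ∑ (λ x → g x + h x) xs ≈ ∑ g xs + ∑ h xs
  ∑-+ g h []       = sym (+-identityˡ 0#)
  ∑-+ g h (x ∷ xs) = trans (+-congˡ (∑-+ g h xs)) (interchange _ _ _ _)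

  ∑-*ˡ : (y : Carrier) (g : A → Carrier) (xs : List A) → ∑ (λ x → y * g x) xs ≈ y * ∑ g xs
  ∑-*ˡ y g []       = sym (zeroʳ y)
  ∑-*ˡ y g (x ∷ xs) = trans (+-congˡ (∑-*ˡ y g xs)) (sym (distribˡ y _ _))

  ∑-neg : (g : A → Carrier) (xs : List A) → ∑ (λ x → - g x) xs ≈ - ∑ g xs
  ∑-neg g []       = sym ε⁻¹≈ε
  ∑-neg g (x ∷ xs) = trans (+-congˡ (∑-neg g xs)) (⁻¹-∙-comm (g x) (∑ g xs))

  ∑-swap : (g : A → B → Carrier) (xs : List A) (ys : List B) →
           ∑ (λ x → ∑ (g x) ys) xs ≈ ∑ (λ y → ∑ (λ x → g x y) xs) ys
  ∑-swap g []       ys = sym (∑-0 ys)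
  ∑-swap g (x ∷ xs) ys = trans (+-congˡ (∑-swap g xs ys)) (sym (∑-+ (g x) _ ys))

  ∑-upTo-suc : (F : ℕ → Carrier) (n : ℕ) → ∑ F (upTo (suc n)) ≈ ∑ F (upTo n) + F n
  ∑-upTo-suc F n = begin
    ∑ F (upTo (suc n))     ≡⟨ ≡.cong (∑ F) (upTo-∷ʳ n) ⟨
    ∑ F (upTo n ∷ʳ n)      ≈⟨ ∑-++ F (upTo n) [ n ] ⟩
    ∑ F (upTo n) + (F n + 0#) ≈⟨ +-congˡ (+-identityʳ (F n)) ⟩
    ∑ F (upTo n) + F n     ∎

  ∑-upTo-truncate : (F : ℕ → Carrier) {M N : ℕ} → M ≤ N → (∀ n → M < n → F n ≈ 0#) →
                    ∑ F (upTo (suc N)) ≈ ∑ F (upTo (suc M))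
  ∑-upTo-truncate F {N = zero}  z≤n     _    = refl
  ∑-upTo-truncate F {M} {suc N} M≤1+N F≈0 with ℕₚ.m≤n⇒m<n∨m≡n M≤1+N
  ... | inj₂ ≡.refl  = refl
  ... | inj₁ M<1+N = begin
    ∑ F (upTo (suc (suc N)))       ≈⟨ ∑-upTo-suc F (suc N) ⟩
    ∑ F (upTo (suc N)) + F (suc N) ≈⟨ +-cong (∑-upTo-truncate F (ℕₚ.≤-pred M<1+N) F≈0) (F≈0 (suc N) M<1+N) ⟩
    ∑ F (upTo (suc M)) + 0#        ≈⟨ +-identityʳ _ ⟩
    ∑ F (upTo (suc M))             ∎

  ∑-upTo-δ : {m N : ℕ} → m ≤ N → (y : Carrier) → ∑ (λ n → [ m ≡ᵇ n ]· y) (upTo (suc N)) ≈ y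
  ∑-upTo-δ {m} {N} m≤N y = begin
    ∑ F (upTo (suc N))     ≈⟨ ∑-upTo-truncate F m≤N (λ n m<n → reflexive (F≡0 (ℕₚ.<⇒≢ m<n))) ⟩
    ∑ F (upTo (suc m))     ≈⟨ ∑-upTo-suc F m ⟩
    ∑ F (upTo m) + F m     ≈⟨ +-cong below (reflexive (≡.cong ([_]· y) (≡ᵇ-refl m))) ⟩
    0# + y                 ≈⟨ +-identityˡ y ⟩
    y                      ∎
    where
    F : ℕ → Carrier
    F n = [ m ≡ᵇ n ]· y
    F≡0 : ∀ {n} → m ≢ n → F n ≡ 0#
    F≡0 m≢n = ≡.cong ([_]· y) (≡ᵇ-false m≢n)
    below : ∑ F (upTo m) ≈ 0#
    below = trans (∑-congᴬ (applyUpTo⁺₁ id m λ n<m → reflexive (F≡0 (ℕₚ.>⇒≢ n<m)))) (∑-0 (upTo m))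

  ∑-allFin-suc : ∀ {n} (g : Fin (suc n) → Carrier) →
                 ∑ g (allFin (suc n)) ≡ g Fin.zero + ∑ (g ∘ Fin.suc) (allFin n)
  ∑-allFin-suc g = ≡.cong (λ xs → g Fin.zero + sumR xs)
    (≡.trans (map-tabulate Fin.suc g) (≡.sym (map-tabulate id (g ∘ Fin.suc))))

  ∑-allFin-const : ∀ n y → ∑ (λ (_ : Fin n) → y) (allFin n) ≈ natR n * y
  ∑-allFin-const zero    y = sym (zeroˡ y)
  ∑-allFin-const (suc n) y = begin
    ∑ (λ _ → y) (allFin (suc n)) ≡⟨ ∑-allFin-suc {n} (λ _ → y) ⟩
    y + ∑ (λ _ → y) (allFin n)   ≈⟨ +-congˡ (∑-allFin-const n y) ⟩
    y + natR n * y               ≈⟨ natR-suc-* n y ⟨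
    natR (suc n) * y             ∎

  ∑-allFin-δ : ∀ {n} (a : Fin n) (G : Fin n → Carrier) → ∑ (λ c → [ ⌊ c ≟ a ⌋ ]· G c) (allFin n) ≈ G a
  ∑-allFin-δ {suc n} Fin.zero G = begin
    ∑ (λ c → [ ⌊ c ≟ Fin.zero ⌋ ]· G c) (allFin (suc n))
      ≡⟨ ∑-allFin-suc {n} (λ c → [ ⌊ c ≟ Fin.zero ⌋ ]· G c) ⟩
    G Fin.zero + ∑ (λ _ → 0#) (allFin n)                ≈⟨ +-congˡ (∑-0 (allFin n)) ⟩
    G Fin.zero + 0#                                      ≈⟨ +-identityʳ _ ⟩
    G Fin.zero                                           ∎
  ∑-allFin-δ {suc n} (Fin.suc a) G = begin
    ∑ (λ c → [ ⌊ c ≟ Fin.suc a ⌋ ]· G c) (allFin (suc n))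
      ≡⟨ ∑-allFin-suc {n} (λ c → [ ⌊ c ≟ Fin.suc a ⌋ ]· G c) ⟩
    0# + ∑ (λ c → [ ⌊ Fin.suc c ≟ Fin.suc a ⌋ ]· G (Fin.suc c)) (allFin n) ≈⟨ +-identityˡ _ ⟩
    ∑ (λ c → [ ⌊ Fin.suc c ≟ Fin.suc a ⌋ ]· G (Fin.suc c)) (allFin n)
      ≈⟨ ∑-cong (allFin n) (λ c → reflexive (≡.cong ([_]· G (Fin.suc c)) (≟-suc c a))) ⟩
    ∑ (λ c → [ ⌊ c ≟ a ⌋ ]· G (Fin.suc c)) (allFin n)                 ≈⟨ ∑-allFin-δ a (G ∘ Fin.suc) ⟩
    G (Fin.suc a)                                                     ∎

  ∑-allFin-if : ∀ {n} (a : Fin n) (G H : Fin n → Carrier) →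
    ∑ (λ c → if ⌊ c ≟ a ⌋ then G c else H c) (allFin n)
      ≈ G a + ∑ (λ c → [ not ⌊ c ≟ a ⌋ ]· H c) (allFin n)
  ∑-allFin-if {n} a G H = begin
    ∑ (λ c → if ⌊ c ≟ a ⌋ then G c else H c) (allFin n)
      ≈⟨ ∑-cong (allFin n) (λ c → if-split ⌊ c ≟ a ⌋ (G c) (H c)) ⟩
    ∑ (λ c → G′ c + H′ c) (allFin n) ≈⟨ ∑-+ G′ H′ (allFin n) ⟩
    ∑ G′ (allFin n) + ∑ H′ (allFin n) ≈⟨ +-congʳ (∑-allFin-δ a G) ⟩
    G a + ∑ H′ (allFin n)            ∎
    where
    G′ H′ : Fin n → Carrier
    G′ c = [ ⌊ c ≟ a ⌋ ]· G c
    H′ c = [ not ⌊ c ≟ a ⌋ ]· H c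

  ∑-allFin-split : ∀ {n} (a : Fin n) (G : Fin n → Carrier) →
    ∑ G (allFin n) ≈ G a + ∑ (λ c → [ not ⌊ c ≟ a ⌋ ]· G c) (allFin n)
  ∑-allFin-split a G =
    trans (∑-cong (allFin _) (λ c → reflexive (≡.sym (if-eta ⌊ c ≟ a ⌋)))) (∑-allFin-if a G G)

  ∑-allFin-≢-const : ∀ {n} (a : Fin (suc n)) y →
                     ∑ (λ c → [ not ⌊ c ≟ a ⌋ ]· y) (allFin (suc n)) ≈ natR n * y
  ∑-allFin-≢-const {n} a y = ∙-cancelˡ y _ _ (begin
    y + ∑ (λ c → [ not ⌊ c ≟ a ⌋ ]· y) (allFin (suc n)) ≈⟨ ∑-allFin-split a (λ _ → y) ⟨
    ∑ (λ _ → y) (allFin (suc n))                      ≈⟨ ∑-allFin-const (suc n) y ⟩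
    natR (suc n) * y                                  ≈⟨ natR-suc-* n y ⟩
    y + natR n * y                                    ∎)

  ∑-allFin-two : ∀ {n} (a : Fin (suc n)) x y →
                 ∑ (λ c → if ⌊ c ≟ a ⌋ then x else y) (allFin (suc n)) ≈ x + natR n * y
  ∑-allFin-two a x y = trans (∑-allFin-if a (λ _ → x) (λ _ → y)) (+-congˡ (∑-allFin-≢-const a y))

  -- Balls and spheres

  module _ (q : ℕ) where

    words-reduced : ∀ n → All (λ w → T (reduced w) × length w ≡ n) (wordsOfLength q n)
    words-reduced zero    = (tt , ≡.refl) ∷ []
    words-reduced (suc n) = concat⁺ (map⁺ (All.map (λ {w} → extend w) (words-reduced n)))
      where
      extend : ∀ w → T (reduced w) × length w ≡ n →
               All (λ y → T (reduced y) × length y ≡ suc n) (filterᵇ reduced (map (_∷ w) (allFin (suc q))))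
      extend w (_ , |w|≡n) = All.zip
        ( all-filter (T? ∘ reduced) (map (_∷ w) (allFin (suc q)))
        , filter⁺ (T? ∘ reduced) (map⁺ {f = _∷ w} (All.universal (λ _ → ≡.cong suc |w|≡n) (allFin (suc q)))))

    ball-reduced : ∀ N → All (λ w → T (reduced w) × length w ≤ N) (ball q N)
    ball-reduced N = concat⁺ (map⁺ (applyUpTo⁺₁ id (suc N) λ {n} n<1+N →
      All.map (λ (r , |w|≡n) → r , ℕₚ.≤-trans (ℕₚ.≤-reflexive |w|≡n) (ℕₚ.≤-pred n<1+N)) (words-reduced n)))

    sphere-reduced : ∀ j v → All (T ∘ reduced) (sphere q j v)
    sphere-reduced j v = filter⁺ (T? ∘ λ w → dist v w ≡ᵇ j) (All.map proj₁ (ball-reduced (length v ℕ.+ j)))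

    ∑-words-suc : ∀ n (g : Word q → Carrier) → ∑ g (wordsOfLength q (suc n)) ≈
      ∑ (λ w → ∑ (λ a → [ reduced (a ∷ w) ]· g (a ∷ w)) (allFin (suc q))) (wordsOfLength q n)
    ∑-words-suc n g = trans (∑-concatMap g extensions (wordsOfLength q n)) (∑-cong (wordsOfLength q n) λ w →
      trans (∑-filterᵇ g reduced (map (_∷ w) (allFin (suc q))))
            (reflexive (∑-map (λ x → [ reduced x ]· g x) (_∷ w) (allFin (suc q)))))
      where
      extensions : Word q → List (Word q)
      extensions w = filterᵇ reduced (map (_∷ w) (allFin (suc q)))

    [dist≡0]·-centre : ∀ (x w : Word q) (H : Word q → Carrier) →
                       [ dist x w ≡ᵇ 0 ]· H w ≡ [ dist x w ≡ᵇ 0 ]· H x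
    [dist≡0]·-centre x w H with dist x w ≡ᵇ 0 in d≡ᵇ0
    ... | false = ≡.refl
    ... | true  = ≡.cong H (≡.sym (dist≡ᵇ0⇒≡ x w d≡ᵇ0))

    ∑-extend-δ : ∀ {b x} → T (reduced (b ∷ x)) → ∀ w y →
      ∑ (λ a → [ reduced (a ∷ w) ]· [ dist (b ∷ x) (a ∷ w) ≡ᵇ 0 ]· y) (allFin (suc q))
        ≈ [ dist x w ≡ᵇ 0 ]· y
    ∑-extend-δ {b} {x} r w y with dist x w ≡ᵇ 0 in d≡ᵇ0
    ... | false = trans (∑-cong (allFin (suc q)) far) (∑-[]·0 (λ a → reduced (a ∷ w)) (allFin (suc q)))
      where
      far : ∀ a → [ reduced (a ∷ w) ]· [ dist (b ∷ x) (a ∷ w) ≡ᵇ 0 ]· y ≈ [ reduced (a ∷ w) ]· 0#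
      far a rewrite dist-∷ b a x w with ⌊ b ≟ a ⌋
      ... | true rewrite d≡ᵇ0 = refl
      ... | false = refl
    ... | true with dist≡ᵇ0⇒≡ x w d≡ᵇ0
    ...   | ≡.refl = trans (∑-cong (allFin (suc q)) pick) (∑-allFin-δ b (λ _ → y))
      where
      pick : ∀ a → [ reduced (a ∷ x) ]· [ dist (b ∷ x) (a ∷ x) ≡ᵇ 0 ]· y ≈ [ ⌊ a ≟ b ⌋ ]· y
      pick a with a ≟ b
      ... | yes ≡.refl rewrite dist-∷-≡ a x x | dist-self x | dec-true (T? (reduced (a ∷ x))) r = refl
      ... | no a≢b rewrite dist-∷-≢ x x (a≢b ∘ ≡.sym) = reflexive (if-eta (reduced (a ∷ x)))

    ∑-words-δ : ∀ n (x : Word q) → T (reduced x) → (y : Carrier) →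
                ∑ (λ w → [ dist x w ≡ᵇ 0 ]· y) (wordsOfLength q n) ≈ [ length x ≡ᵇ n ]· y
    ∑-words-δ zero    x _ y = trans (+-identityʳ _) (reflexive (≡.cong (λ d → [ d ≡ᵇ 0 ]· y) (dist-[]ʳ x)))
    ∑-words-δ (suc n) [] _ y = begin
      ∑ (λ w → [ dist [] w ≡ᵇ 0 ]· y) (wordsOfLength q (suc n))
        ≈⟨ ∑-words-suc n (λ w → [ dist [] w ≡ᵇ 0 ]· y) ⟩
      ∑ (λ w → ∑ (λ a → [ reduced (a ∷ w) ]· 0#) (allFin (suc q))) (wordsOfLength q n)
        ≈⟨ ∑-cong (wordsOfLength q n) (λ w → ∑-[]·0 (λ a → reduced (a ∷ w)) (allFin (suc q))) ⟩
      ∑ (λ _ → 0#) (wordsOfLength q n) ≈⟨ ∑-0 (wordsOfLength q n) ⟩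
      0#                               ∎
    ∑-words-δ (suc n) (b ∷ x) r y = begin
      ∑ (λ w → [ dist (b ∷ x) w ≡ᵇ 0 ]· y) (wordsOfLength q (suc n))
        ≈⟨ ∑-words-suc n (λ w → [ dist (b ∷ x) w ≡ᵇ 0 ]· y) ⟩
      ∑ (λ w → ∑ (λ a → [ reduced (a ∷ w) ]· [ dist (b ∷ x) (a ∷ w) ≡ᵇ 0 ]· y) (allFin (suc q))) (wordsOfLength q n)
        ≈⟨ ∑-cong (wordsOfLength q n) (λ w → ∑-extend-δ {b} {x} r w y) ⟩
      ∑ (λ w → [ dist x w ≡ᵇ 0 ]· y) (wordsOfLength q n) ≈⟨ ∑-words-δ n x (reduced-tail {a = b} x r) y ⟩
      [ length x ≡ᵇ n ]· y ∎

    ∑-ball-truncate : (G : Word q → Carrier) {M N : ℕ} → M ≤ N → (∀ w → M < length w → G w ≈ 0#) →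
                      ∑ G (ball q N) ≈ ∑ G (ball q M)
    ∑-ball-truncate G {M} {N} M≤N G≈0 = begin
      ∑ G (ball q N)                                   ≈⟨ ∑-concatMap G (wordsOfLength q) (upTo (suc N)) ⟩
      ∑ (λ n → ∑ G (wordsOfLength q n)) (upTo (suc N)) ≈⟨ ∑-upTo-truncate _ M≤N long ⟩
      ∑ (λ n → ∑ G (wordsOfLength q n)) (upTo (suc M)) ≈⟨ ∑-concatMap G (wordsOfLength q) (upTo (suc M)) ⟨
      ∑ G (ball q M)                                   ∎
      where
      long : ∀ n → M < n → ∑ G (wordsOfLength q n) ≈ 0#
      long n M<n = trans (∑-congᴬ (All.map (λ {w} (_ , |w|≡n) → G≈0 w (≡.subst (M <_) (≡.sym |w|≡n) M<n))
                                           (words-reduced n)))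
                         (∑-0 (wordsOfLength q n))

    ∑-sphere : ∀ j (x : Word q) {N} (f : Fn q) → length x ℕ.+ j ≤ N →
               ∑ f (sphere q j x) ≈ ∑ (λ w → [ dist x w ≡ᵇ j ]· f w) (ball q N)
    ∑-sphere j x {N} f x+j≤N = begin
      ∑ f (sphere q j x)                ≈⟨ ∑-filterᵇ f (λ w → dist x w ≡ᵇ j) (ball q (length x ℕ.+ j)) ⟩
      ∑ G (ball q (length x ℕ.+ j))     ≈⟨ ∑-ball-truncate G x+j≤N outside ⟨
      ∑ G (ball q N)                    ∎
      where
      G : Fn q
      G w = [ dist x w ≡ᵇ j ]· f w

      outside : ∀ w → length x ℕ.+ j < length w → G w ≈ 0#
      outside w long = reflexive (≡.cong ([_]· f w) (≡ᵇ-false (long⇒dist≢ x w long)))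

    ∑-ball-δ : ∀ (x : Word q) {N} → T (reduced x) → length x ≤ N → (y : Carrier) →
               ∑ (λ w → [ dist x w ≡ᵇ 0 ]· y) (ball q N) ≈ y
    ∑-ball-δ x {N} r |x|≤N y = begin
      ∑ (λ w → [ dist x w ≡ᵇ 0 ]· y) (ball q N)
        ≈⟨ ∑-concatMap (λ w → [ dist x w ≡ᵇ 0 ]· y) (wordsOfLength q) (upTo (suc N)) ⟩
      ∑ (λ n → ∑ (λ w → [ dist x w ≡ᵇ 0 ]· y) (wordsOfLength q n)) (upTo (suc N))
        ≈⟨ ∑-cong (upTo (suc N)) (λ n → ∑-words-δ n x r y) ⟩
      ∑ (λ n → [ length x ≡ᵇ n ]· y) (upTo (suc N)) ≈⟨ ∑-upTo-δ |x|≤N y ⟩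
      y ∎

    ∑-sphere₀ : ∀ v → T (reduced v) → (f : Fn q) → ∑ f (sphere q 0 v) ≈ f v
    ∑-sphere₀ v r f = begin
      ∑ f (sphere q 0 v)                     ≈⟨ ∑-filterᵇ f (λ u → dist v u ≡ᵇ 0) ball₀ ⟩
      ∑ (λ u → [ dist v u ≡ᵇ 0 ]· f u) ball₀ ≈⟨ ∑-cong ball₀ (λ u → reflexive ([dist≡0]·-centre v u f)) ⟩
      ∑ (λ u → [ dist v u ≡ᵇ 0 ]· f v) ball₀ ≈⟨ ∑-ball-δ v r (ℕₚ.m≤m+n (length v) 0) (f v) ⟩
      f v                                    ∎
      where
      ball₀ : List (Word q)
      ball₀ = ball q (length v ℕ.+ 0)

    -- Neighbours

    lettersExcept : Fin (suc q) → List (Fin (suc q))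
    lettersExcept a = filterᵇ (λ c → not ⌊ c ≟ a ⌋) (allFin (suc q))

    nbrs : Word q → List (Word q)
    nbrs []          = map [_] (allFin (suc q))
    nbrs (a ∷ [])    = [] ∷ map (λ c → a ∷ c ∷ []) (lettersExcept a)
    nbrs (a ∷ b ∷ v) = map (a ∷_) (nbrs (b ∷ v))

    nbrs-length≤ : ∀ v → All (λ x → length x ≤ length v ℕ.+ 1) (nbrs v)
    nbrs-length≤ []          = map⁺ (All.universal (λ _ → ℕₚ.≤-refl) (allFin (suc q)))
    nbrs-length≤ (a ∷ [])    = z≤n ∷ map⁺ (All.universal (λ _ → ℕₚ.≤-refl) _)
    nbrs-length≤ (a ∷ b ∷ v) = map⁺ (All.map s≤s (nbrs-length≤ (b ∷ v)))

    lettersExcept-reduced : ∀ a → All (λ c → T (reduced (a ∷ c ∷ []))) (lettersExcept a)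
    lettersExcept-reduced a = All.map (λ c≢a → ∷-reduced [] (≡.≢-sym (toWitnessFalse c≢a)) tt)
                                      (all-filter (T? ∘ λ c → not ⌊ c ≟ a ⌋) (allFin (suc q)))

    nbrs-∷-reduced : ∀ {a b} v → a ≢ b → T (reduced (b ∷ v)) →
                     All (λ x → T (reduced (a ∷ x))) (nbrs (b ∷ v))
    nbrs-∷-reduced {b = b} []       a≢b _ =
      tt ∷ map⁺ (All.map (λ {c} → ∷-reduced (c ∷ []) a≢b) (lettersExcept-reduced b))
    nbrs-∷-reduced         (b′ ∷ v) a≢b r =
      map⁺ (All.map (λ {x} → ∷-reduced x a≢b) (nbrs-∷-reduced v (reduced-head v r) (reduced-tail (b′ ∷ v) r)))

    nbrs-reduced : ∀ v → T (reduced v) → All (T ∘ reduced) (nbrs v)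
    nbrs-reduced []          _ = map⁺ (All.universal (λ _ → tt) (allFin (suc q)))
    nbrs-reduced (a ∷ [])    _ = tt ∷ map⁺ (lettersExcept-reduced a)
    nbrs-reduced (a ∷ b ∷ v) r = map⁺ (nbrs-∷-reduced v (reduced-head v r) (reduced-tail (b ∷ v) r))

    ∑-nbrs-[a] : ∀ a (G : Word q → Carrier) →
      ∑ G (nbrs (a ∷ [])) ≈ G [] + ∑ (λ c → [ not ⌊ c ≟ a ⌋ ]· G (a ∷ c ∷ [])) (allFin (suc q))
    ∑-nbrs-[a] a G = +-congˡ (trans (reflexive (∑-map G (λ c → a ∷ c ∷ []) (lettersExcept a)))
                                     (∑-filterᵇ (λ c → G (a ∷ c ∷ [])) (λ c → not ⌊ c ≟ a ⌋) (allFin (suc q))))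

    -- The sum of g (d(x,u)) over the neighbours x of v when d = d(v,u): all q+1 neighbours
    -- are farther from u if v = u, otherwise exactly one of them is closer.
    nbrDistSum : ℕ → (ℕ → Carrier) → Carrier
    nbrDistSum zero    g = natR (suc q) * g 1
    nbrDistSum (suc d) g = g d + natR q * g (suc (suc d))

    ∑-nbrs-length : ∀ v (g : ℕ → Carrier) → ∑ (g ∘ length) (nbrs v) ≈ nbrDistSum (length v) g
    ∑-nbrs-length []          g = trans (reflexive (∑-map (g ∘ length) [_] (allFin (suc q))))
                                        (∑-allFin-const (suc q) (g 1))
    ∑-nbrs-length (a ∷ [])    g = trans (∑-nbrs-[a] a (g ∘ length)) (+-congˡ (∑-allFin-≢-const a (g 2)))
    ∑-nbrs-length (a ∷ b ∷ v) g = trans (reflexive (∑-map (g ∘ length) (a ∷_) (nbrs (b ∷ v))))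
                                        (∑-nbrs-length (b ∷ v) (g ∘ suc))

    ∑-allFin-dist : ∀ b u (g : ℕ → Carrier) →
                    ∑ (λ c → g (dist (c ∷ []) (b ∷ u))) (allFin (suc q)) ≈ nbrDistSum (length (b ∷ u)) g
    ∑-allFin-dist b u g = begin
      ∑ (λ c → g (dist (c ∷ []) (b ∷ u))) (allFin (suc q))
        ≈⟨ ∑-cong (allFin (suc q)) (λ c → reflexive (≡.trans (≡.cong g (dist-∷ c b [] u)) (if-float g ⌊ c ≟ b ⌋))) ⟩
      ∑ (λ c → if ⌊ c ≟ b ⌋ then g (length u) else g (suc (suc (length u)))) (allFin (suc q))
        ≈⟨ ∑-allFin-two b _ _ ⟩
      g (length u) + natR q * g (suc (suc (length u))) ∎

    ∑-nbrs-[a]-dist-≢ : ∀ {a b} u (g : ℕ → Carrier) → a ≢ b →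
      ∑ (λ x → g (dist x (b ∷ u))) (nbrs (a ∷ [])) ≈ nbrDistSum (dist (a ∷ []) (b ∷ u)) g
    ∑-nbrs-[a]-dist-≢ {a} {b} u g a≢b = begin
      ∑ (λ x → g (dist x (b ∷ u))) (nbrs (a ∷ []))
        ≈⟨ ∑-nbrs-[a] a (λ x → g (dist x (b ∷ u))) ⟩
      g (suc (length u)) + ∑ (λ c → [ not ⌊ c ≟ a ⌋ ]· g (dist (a ∷ c ∷ []) (b ∷ u))) (allFin (suc q))
        ≈⟨ +-congˡ (∑-cong (allFin (suc q)) λ c →
             reflexive (≡.cong (λ d → [ not ⌊ c ≟ a ⌋ ]· g d) (dist-∷-≢ (c ∷ []) u a≢b))) ⟩
      g (suc (length u)) + ∑ (λ c → [ not ⌊ c ≟ a ⌋ ]· g (suc (suc (suc (length u))))) (allFin (suc q))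
        ≈⟨ +-congˡ (∑-allFin-≢-const a _) ⟩
      nbrDistSum (suc (suc (length u))) g ≡⟨ ≡.cong (λ d → nbrDistSum d g) (dist-∷-≢ [] u a≢b) ⟨
      nbrDistSum (dist (a ∷ []) (b ∷ u)) g ∎

    ∑-nbrs-[a]-dist-≡ : ∀ a u (g : ℕ → Carrier) → T (reduced (a ∷ u)) →
      ∑ (λ x → g (dist x (a ∷ u))) (nbrs (a ∷ [])) ≈ nbrDistSum (dist (a ∷ []) (a ∷ u)) g
    ∑-nbrs-[a]-dist-≡ a [] g _ = begin
      ∑ (λ x → g (dist x (a ∷ []))) (nbrs (a ∷ []))
        ≈⟨ ∑-nbrs-[a] a (λ x → g (dist x (a ∷ []))) ⟩
      g 1 + ∑ (λ c → [ not ⌊ c ≟ a ⌋ ]· g (dist (a ∷ c ∷ []) (a ∷ []))) (allFin (suc q))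
        ≈⟨ +-congˡ (∑-cong (allFin (suc q)) λ c →
             reflexive (≡.cong (λ d → [ not ⌊ c ≟ a ⌋ ]· g d) (dist-∷-≡ a (c ∷ []) []))) ⟩
      g 1 + ∑ (λ c → [ not ⌊ c ≟ a ⌋ ]· g 1) (allFin (suc q)) ≈⟨ +-congˡ (∑-allFin-≢-const a (g 1)) ⟩
      g 1 + natR q * g 1                    ≈⟨ natR-suc-* q (g 1) ⟨
      nbrDistSum 0 g                        ≡⟨ ≡.cong (λ d → nbrDistSum d g) (dist-self (a ∷ [])) ⟨
      nbrDistSum (dist (a ∷ []) (a ∷ [])) g ∎
    ∑-nbrs-[a]-dist-≡ a (b ∷ u) g r = begin
      ∑ (λ x → g (dist x (a ∷ b ∷ u))) (nbrs (a ∷ []))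
        ≈⟨ ∑-nbrs-[a] a (λ x → g (dist x (a ∷ b ∷ u))) ⟩
      g (suc (suc (length u))) + ∑ (λ c → [ not ⌊ c ≟ a ⌋ ]· g (dist (a ∷ c ∷ []) (a ∷ b ∷ u))) (allFin (suc q))
        ≈⟨ +-cong (reflexive (≡.cong g (≡.sym (dist-∷-≢ [] u (reduced-head u r)))))
                  (∑-cong (allFin (suc q)) λ c →
                     reflexive (≡.cong (λ d → [ not ⌊ c ≟ a ⌋ ]· g d) (dist-∷-≡ a (c ∷ []) (b ∷ u)))) ⟩
      H a + ∑ (λ c → [ not ⌊ c ≟ a ⌋ ]· H c) (allFin (suc q)) ≈⟨ ∑-allFin-split a H ⟨
      ∑ H (allFin (suc q))                     ≈⟨ ∑-allFin-dist b u g ⟩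
      nbrDistSum (length (b ∷ u)) g            ≡⟨ ≡.cong (λ d → nbrDistSum d g) (dist-∷-≡ a [] (b ∷ u)) ⟨
      nbrDistSum (dist (a ∷ []) (a ∷ b ∷ u)) g ∎
      where
      H : Fin (suc q) → Carrier
      H c = g (dist (c ∷ []) (b ∷ u))

    ∑-nbrs-dist : ∀ v u → T (reduced u) → (g : ℕ → Carrier) →
                  ∑ (λ x → g (dist x u)) (nbrs v) ≈ nbrDistSum (dist v u) g
    ∑-nbrs-dist v [] _ g = begin
      ∑ (λ x → g (dist x [])) (nbrs v) ≈⟨ ∑-cong (nbrs v) (λ x → reflexive (≡.cong g (dist-[]ʳ x))) ⟩
      ∑ (g ∘ length) (nbrs v)          ≈⟨ ∑-nbrs-length v g ⟩
      nbrDistSum (length v) g          ≡⟨ ≡.cong (λ d → nbrDistSum d g) (dist-[]ʳ v) ⟨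
      nbrDistSum (dist v []) g         ∎
    ∑-nbrs-dist [] (b ∷ u) _ g =
      trans (reflexive (∑-map (λ x → g (dist x (b ∷ u))) [_] (allFin (suc q)))) (∑-allFin-dist b u g)
    ∑-nbrs-dist (a ∷ []) (b ∷ u) r g = heads (a ≟ b) r
      where
      heads : Dec (a ≡ b) → T (reduced (b ∷ u)) →
              ∑ (λ x → g (dist x (b ∷ u))) (nbrs (a ∷ [])) ≈ nbrDistSum (dist (a ∷ []) (b ∷ u)) g
      heads (yes ≡.refl) r = ∑-nbrs-[a]-dist-≡ a u g r
      heads (no a≢b)     _ = ∑-nbrs-[a]-dist-≢ u g a≢b
    ∑-nbrs-dist (a ∷ b ∷ v) (c ∷ u) r g = heads (a ≟ c)
      where
      heads : Dec (a ≡ c) →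
              ∑ (λ x → g (dist x (c ∷ u))) (nbrs (a ∷ b ∷ v)) ≈ nbrDistSum (dist (a ∷ b ∷ v) (c ∷ u)) g
      heads (yes ≡.refl) = begin
        ∑ (λ x → g (dist x (a ∷ u))) (map (a ∷_) (nbrs (b ∷ v)))
          ≡⟨ ∑-map (λ x → g (dist x (a ∷ u))) (a ∷_) (nbrs (b ∷ v)) ⟩
        ∑ (λ x → g (dist (a ∷ x) (a ∷ u))) (nbrs (b ∷ v))
          ≈⟨ ∑-cong (nbrs (b ∷ v)) (λ x → reflexive (≡.cong g (dist-∷-≡ a x u))) ⟩
        ∑ (λ x → g (dist x u)) (nbrs (b ∷ v))   ≈⟨ ∑-nbrs-dist (b ∷ v) u (reduced-tail u r) g ⟩
        nbrDistSum (dist (b ∷ v) u) g           ≡⟨ ≡.cong (λ d → nbrDistSum d g) (dist-∷-≡ a (b ∷ v) u) ⟨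
        nbrDistSum (dist (a ∷ b ∷ v) (a ∷ u)) g ∎
      heads (no a≢c) = begin
        ∑ (λ x → g (dist x (c ∷ u))) (map (a ∷_) (nbrs (b ∷ v)))
          ≡⟨ ∑-map (λ x → g (dist x (c ∷ u))) (a ∷_) (nbrs (b ∷ v)) ⟩
        ∑ (λ x → g (dist (a ∷ x) (c ∷ u))) (nbrs (b ∷ v))
          ≈⟨ ∑-cong (nbrs (b ∷ v)) (λ x → reflexive (≡.cong g (dist-∷-≢ x u a≢c))) ⟩
        ∑ (λ x → g (suc (length x) ℕ.+ suc (length u))) (nbrs (b ∷ v))
          ≈⟨ ∑-nbrs-length (b ∷ v) (λ n → g (suc n ℕ.+ suc (length u))) ⟩
        nbrDistSum (suc (suc (length v)) ℕ.+ suc (length u)) g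
          ≡⟨ ≡.cong (λ d → nbrDistSum d g) (dist-∷-≢ (b ∷ v) u a≢c) ⟨
        nbrDistSum (dist (a ∷ b ∷ v) (c ∷ u)) g ∎

    nbrDistSum-δ : ∀ d y → nbrDistSum d (λ n → [ n ≡ᵇ 0 ]· y) ≈ [ d ≡ᵇ 1 ]· y
    nbrDistSum-δ zero    y = zeroʳ _
    nbrDistSum-δ (suc d) y = trans (+-congˡ (zeroʳ _)) (+-identityʳ _)

    -- For u at distance k from v, the number of neighbours of v at distance k+1 from u.
    farNbrs : ℕ → ℕ
    farNbrs zero    = suc q
    farNbrs (suc _) = q

    nbrDistSum-sphere : ∀ d k y →
      nbrDistSum d (λ n → [ n ≡ᵇ suc k ]· y) ≈ [ d ≡ᵇ suc (suc k) ]· y + natR (farNbrs k) * [ d ≡ᵇ k ]· y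
    nbrDistSum-sphere zero    zero    y = sym (+-identityˡ _)
    nbrDistSum-sphere zero    (suc k) y = trans (zeroʳ _) (sym (trans (+-identityˡ _) (zeroʳ _)))
    nbrDistSum-sphere (suc d) zero    y = +-congˡ (trans (zeroʳ _) (sym (zeroʳ _)))
    nbrDistSum-sphere (suc d) (suc k) y = refl

    ∑-sphere₁ : ∀ v → T (reduced v) → (H : Fn q) → ∑ H (sphere q 1 v) ≈ ∑ H (nbrs v)
    ∑-sphere₁ v r H = begin
      ∑ H (sphere q 1 v)                        ≈⟨ ∑-filterᵇ H (λ w → dist v w ≡ᵇ 1) (ball q N) ⟩
      ∑ (λ w → [ dist v w ≡ᵇ 1 ]· H w) (ball q N)
        ≈⟨ ∑-congᴬ (All.map (λ {w} (rw , _) → pick w rw) (ball-reduced N)) ⟩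
      ∑ (λ w → ∑ (δ w) (nbrs v)) (ball q N)       ≈⟨ ∑-swap δ (ball q N) (nbrs v) ⟩
      ∑ (λ x → ∑ (λ w → δ w x) (ball q N)) (nbrs v)
        ≈⟨ ∑-congᴬ (All.zipWith (λ {x} (rx , |x|≤N) → ∑-ball-δ x rx |x|≤N (H x))
                                (nbrs-reduced v r , nbrs-length≤ v)) ⟩
      ∑ H (nbrs v)                                ∎
      where
      N : ℕ
      N = length v ℕ.+ 1
      δ : Word q → Word q → Carrier
      δ w x = [ dist x w ≡ᵇ 0 ]· H x
      pick : ∀ w → T (reduced w) → [ dist v w ≡ᵇ 1 ]· H w ≈ ∑ (δ w) (nbrs v)
      pick w rw = begin
        [ dist v w ≡ᵇ 1 ]· H w                             ≈⟨ nbrDistSum-δ (dist v w) (H w) ⟨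
        nbrDistSum (dist v w) (λ n → [ n ≡ᵇ 0 ]· H w)      ≈⟨ ∑-nbrs-dist v w rw (λ n → [ n ≡ᵇ 0 ]· H w) ⟨
        ∑ (λ x → [ dist x w ≡ᵇ 0 ]· H w) (nbrs v)
          ≈⟨ ∑-cong (nbrs v) (λ x → reflexive ([dist≡0]·-centre x w H)) ⟩
        ∑ (δ w) (nbrs v)                                   ∎

    ∑-sphere-rec : ∀ v → T (reduced v) → ∀ k (f : Fn q) →
      ∑ (λ w → ∑ f (sphere q (suc k) w)) (sphere q 1 v)
        ≈ ∑ f (sphere q (suc (suc k)) v) + natR (farNbrs k) * ∑ f (sphere q k v)
    ∑-sphere-rec v r k f = begin
      ∑ (λ w → ∑ f (sphere q (suc k) w)) (sphere q 1 v)  ≈⟨ ∑-sphere₁ v r (λ w → ∑ f (sphere q (suc k) w)) ⟩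
      ∑ (λ x → ∑ f (sphere q (suc k) x)) (nbrs v)
        ≈⟨ ∑-congᴬ (All.map (λ {x} |x|≤ → ∑-sphere (suc k) x f (inBall x |x|≤)) (nbrs-length≤ v)) ⟩
      ∑ (λ x → ∑ (λ u → S x u) (ball q N)) (nbrs v)      ≈⟨ ∑-swap S (nbrs v) (ball q N) ⟩
      ∑ (λ u → ∑ (λ x → S x u) (nbrs v)) (ball q N)
        ≈⟨ ∑-congᴬ (All.map (λ {u} (ru , _) → count u ru) (ball-reduced N)) ⟩
      ∑ (λ u → S₂ u + natR (farNbrs k) * S₀ u) (ball q N)
        ≈⟨ trans (∑-+ S₂ (λ u → natR (farNbrs k) * S₀ u) (ball q N)) (+-congˡ (∑-*ˡ _ S₀ (ball q N))) ⟩
      ∑ S₂ (ball q N) + natR (farNbrs k) * ∑ S₀ (ball q N)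
        ≈⟨ +-cong (∑-sphere (suc (suc k)) v f ℕₚ.≤-refl)
                  (*-congˡ (∑-sphere k v f (ℕₚ.+-monoʳ-≤ (length v) (ℕₚ.m≤n+m k 2)))) ⟨
      ∑ f (sphere q (suc (suc k)) v) + natR (farNbrs k) * ∑ f (sphere q k v) ∎
      where
      N : ℕ
      N = length v ℕ.+ suc (suc k)
      S : Word q → Word q → Carrier
      S x u = [ dist x u ≡ᵇ suc k ]· f u
      S₂ S₀ : Fn q
      S₂ u = [ dist v u ≡ᵇ suc (suc k) ]· f u
      S₀ u = [ dist v u ≡ᵇ k ]· f u
      inBall : ∀ (x : Word q) → length x ≤ length v ℕ.+ 1 → length x ℕ.+ suc k ≤ N
      inBall x |x|≤ = ℕₚ.≤-trans (ℕₚ.+-monoˡ-≤ (suc k) |x|≤) (ℕₚ.≤-reflexive (ℕₚ.+-assoc (length v) 1 (suc k)))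
      count : ∀ u → T (reduced u) → ∑ (λ x → S x u) (nbrs v) ≈ S₂ u + natR (farNbrs k) * S₀ u
      count u ru = trans (∑-nbrs-dist v u ru (λ n → [ n ≡ᵇ suc k ]· f u)) (nbrDistSum-sphere (dist v u) k (f u))

  -- Mean value operators

  -- Functions on words are junk off the reduced words, so they are compared there only.
  infix 4 _≈ᴿ_
  _≈ᴿ_ : ∀ {q} → Fn q → Fn q → Set ℓ
  g ≈ᴿ g′ = ∀ v → T (reduced v) → g v ≈ g′ v

  ≈ᴿ-setoid : ℕ → Setoid c ℓ
  ≈ᴿ-setoid q = record
    { Carrier       = Fn q
    ; _≈_           = _≈ᴿ_
    ; isEquivalence = record
      { refl  = λ _ _ → refl
      ; sym   = λ g≈g′ v r → sym (g≈g′ v r)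
      ; trans = λ g≈g′ g′≈g″ v r → trans (g≈g′ v r) (g′≈g″ v r)
      }
    }

  -- With r = 1/√q, the three-term recurrence reads μ_{k+2} = meanStep μ₁ r μ_{k+1} μ_k.
  meanStep : ∀ {q} → Op q → Carrier → Fn q → Fn q → Fn q
  meanStep {q} M r g h v = (r * r) * (natR (suc q) * M g v - h v)

  meanStep-cong : ∀ {q} (M : Op q) r → (∀ {g g′} → g ≈ᴿ g′ → ∀ v → M g v ≈ M g′ v) →
                  Congruent₂ _≈ᴿ_ (meanStep M r)
  meanStep-cong M r M-cong g≈g′ h≈h′ v rv = *-congˡ (+-cong (*-congˡ (M-cong g≈g′ v)) (-‿cong (h≈h′ v rv)))

  module _ (q : ℕ) (sInv t : Carrier) where

    μ[_] : ℕ → Op q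
    μ[ k ] = μ q sInv t k

    μ₁-cong : ∀ {g g′} → g ≈ᴿ g′ → ∀ v → μ[ 1 ] g v ≈ μ[ 1 ] g′ v
    μ₁-cong g≈g′ v = *-congˡ (∑-congᴬ (All.map (λ {u} → g≈g′ u) (sphere-reduced q 1 v)))

    μ₁-*ˡ : ∀ a g v → μ[ 1 ] (λ u → a * g u) v ≈ a * μ[ 1 ] g v
    μ₁-*ˡ a g v = trans (*-congˡ (∑-*ˡ a g (sphere q 1 v))) (x∙yz≈y∙xz _ a _)

    μ₁-- : ∀ g g′ v → μ[ 1 ] (λ u → g u - g′ u) v ≈ μ[ 1 ] g v - μ[ 1 ] g′ v
    μ₁-- g g′ v = trans (*-congˡ (trans (∑-+ g (λ u → - g′ u) (sphere q 1 v)) (+-congˡ (∑-neg g′ (sphere q 1 v)))))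
                        (x[y-z]≈xy-xz _ _ _)

    module _ (q·sInv²≈1 : natR q * (sInv * sInv) ≈ 1#) ([q+1]t≈1 : natR (suc q) * t ≈ 1#) where

      μ-farNbrs : ∀ v → T (reduced v) → ∀ k (f : Fn q) →
                  natR (farNbrs q k) * ((t * pow sInv (2 ℕ.* k)) * ∑ f (sphere q k v)) ≈ μ[ k ] f v
      μ-farNbrs v r zero f = begin
        natR (suc q) * ((t * 1#) * Σ₀) ≈⟨ *-congˡ (*-congʳ (*-identityʳ t)) ⟩
        natR (suc q) * (t * Σ₀)        ≈⟨ *-assoc _ _ _ ⟨
        (natR (suc q) * t) * Σ₀        ≈⟨ *-congʳ [q+1]t≈1 ⟩
        1# * Σ₀                        ≈⟨ *-identityˡ Σ₀ ⟩
        Σ₀                             ≈⟨ ∑-sphere₀ q v r f ⟩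
        f v                            ∎
        where
        Σ₀ : Carrier
        Σ₀ = ∑ f (sphere q 0 v)
      μ-farNbrs v r (suc k) f = begin
        natR q * ((t * pow sInv (2 ℕ.* suc k)) * Σ)  ≡⟨ ≡.cong (λ p → natR q * ((t * p) * Σ)) (pow-2*suc sInv k) ⟩
        natR q * ((t * (sInv * (sInv * P))) * Σ)
          ≈⟨ solve 5 (λ Q t r P S → Q :* ((t :* (r :* (r :* P))) :* S) := (Q :* (r :* r)) :* ((t :* P) :* S))
                     refl (natR q) t sInv P Σ ⟩
        (natR q * (sInv * sInv)) * ((t * P) * Σ)    ≈⟨ *-congʳ q·sInv²≈1 ⟩
        1# * ((t * P) * Σ)                          ≈⟨ *-identityˡ _ ⟩
        (t * P) * Σ                                 ∎
        where
        P Σ : Carrier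
        P = pow sInv (2 ℕ.* k)
        Σ = ∑ f (sphere q (suc k) v)

      μ-rec : ∀ k f → μ[ suc (suc k) ] f ≈ᴿ meanStep μ[ 1 ] sInv (μ[ suc k ] f) (μ[ k ] f)
      μ-rec k f v r = sym (begin
        (sInv * sInv) * (natR (suc q) * μ[ 1 ] (μ[ suc k ] f) v - μ[ k ] f v)
          ≈⟨ *-congˡ (+-congʳ (*-congˡ μ₁μ)) ⟩
        (sInv * sInv) * (natR (suc q) * ((t * 1#) * (tP * (Σ₂ + F * Σ₀))) - μ[ k ] f v)
          ≈⟨ *-congˡ (+-congʳ expand) ⟩
        (sInv * sInv) * (tP * Σ₂ + F * (tP * Σ₀) - μ[ k ] f v)
          ≈⟨ *-congˡ (+-congʳ (+-congˡ (μ-farNbrs v r k f))) ⟩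
        (sInv * sInv) * (tP * Σ₂ + μ[ k ] f v - μ[ k ] f v)
          ≈⟨ *-congˡ (x+y-y≈x _ _) ⟩
        (sInv * sInv) * (tP * Σ₂)
          ≈⟨ solve 4 (λ r t P S → (r :* r) :* ((t :* P) :* S) := (t :* (r :* (r :* P))) :* S) refl sInv t P Σ₂ ⟩
        (t * (sInv * (sInv * P))) * Σ₂
          ≡⟨ ≡.cong (λ p → (t * p) * Σ₂) (pow-2*suc sInv k) ⟨
        μ[ suc (suc k) ] f v ∎)
        where
        P tP Σ₂ Σ₀ F : Carrier
        P = pow sInv (2 ℕ.* k)
        tP = t * P
        Σ₂ = ∑ f (sphere q (suc (suc k)) v)
        Σ₀ = ∑ f (sphere q k v)
        F = natR (farNbrs q k)
        μ₁μ : μ[ 1 ] (μ[ suc k ] f) v ≈ (t * 1#) * (tP * (Σ₂ + F * Σ₀))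
        μ₁μ = *-congˡ (trans (∑-*ˡ tP (λ w → ∑ f (sphere q (suc k) w)) (sphere q 1 v))
                             (*-congˡ (∑-sphere-rec q v r k f)))
        expand : natR (suc q) * ((t * 1#) * (tP * (Σ₂ + F * Σ₀))) ≈ tP * Σ₂ + F * (tP * Σ₀)
        expand = begin
          natR (suc q) * ((t * 1#) * (tP * (Σ₂ + F * Σ₀))) ≈⟨ *-congˡ (*-congʳ (*-identityʳ t)) ⟩
          natR (suc q) * (t * (tP * (Σ₂ + F * Σ₀)))        ≈⟨ *-assoc _ _ _ ⟨
          (natR (suc q) * t) * (tP * (Σ₂ + F * Σ₀))        ≈⟨ trans (*-congʳ [q+1]t≈1) (*-identityˡ _) ⟩
          tP * (Σ₂ + F * Σ₀)                                ≈⟨ distribˡ tP Σ₂ (F * Σ₀) ⟩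
          tP * Σ₂ + tP * (F * Σ₀)                           ≈⟨ +-congˡ (x∙yz≈y∙xz tP F Σ₀) ⟩
          tP * Σ₂ + F * (tP * Σ₀)                           ∎

  -- Chebyshev polynomials

  chebyshev-rearrange : ∀ s b c x y z →
    s * (b * (c * x) - y) - (b * (c * y) - z) ≈ b * (c * (s * x - y)) - (s * y - z)
  chebyshev-rearrange s b c x y z = begin
    s * (b * (c * x) - y) - (b * (c * y) - z)        ≈⟨ +-congˡ (-‿sub _ z) ⟩
    s * (b * (c * x) - y) + (- (b * (c * y)) + z)
      ≈⟨ +-congˡ (+-congʳ (trans (-‿distribʳ-* b _) (*-congˡ (-‿distribʳ-* c y)))) ⟩
    s * (b * (c * x) + - y) + (b * (c * - y) + z)
      ≈⟨ solve 6 (λ s b c x y′ z → s :* (b :* (c :* x) :+ y′) :+ (b :* (c :* y′) :+ z)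
                                  := b :* (c :* (s :* x :+ y′)) :+ (s :* y′ :+ z)) refl s b c x (- y) z ⟩
    b * (c * (s * x + - y)) + (s * - y + z)          ≈⟨ +-congˡ (+-congʳ (-‿distribʳ-* s y)) ⟨
    b * (c * (s * x - y)) + (- (s * y) + z)          ≈⟨ +-congˡ (-‿sub _ z) ⟨
    b * (c * (s * x - y)) - (s * y - z)              ∎

  module Chebyshev {q : ℕ} (M : Op q)
    (M-cong : ∀ {g g′} → g ≈ᴿ g′ → ∀ v → M g v ≈ M g′ v)
    (M-*ˡ : ∀ a g v → M (λ u → a * g u) v ≈ a * M g v)
    (M-- : ∀ g g′ v → M (λ u → g u - g′ u) v ≈ M g v - M g′ v)
    (c₀ s : Carrier) where

    M-0 : ∀ v → M (λ _ → 0#) v ≈ 0#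
    M-0 v = trans (M-cong (λ _ _ → sym (zeroˡ 0#)) v) (trans (M-*ˡ 0# (λ _ → 0#) v) (zeroˡ _))

    C : ℕ → Op q
    C = chebU (scaleOp c₀ M)

    -- Φ k = s M U_{k-1}(A) − U_{k-2}(A) for A = c₀ M, as C n = U_{n-2}(A); for M = μ₁ and
    -- s = √q it is the bracket in the statement.
    Φ : ℕ → Op q
    Φ k f v = s * M (C (suc k) f) v - C k f v

    Φ-0 : ∀ f v → Φ 0 f v ≈ f v
    Φ-0 f v = trans (+-cong (trans (*-congˡ (M-0 v)) (zeroʳ s)) (⁻¹-involutive (f v))) (+-identityˡ (f v))

    Φ-1 : ∀ f v → Φ 1 f v ≈ s * M f v
    Φ-1 f v = trans (x-0≈x _) (*-congˡ (M-cong C₂≈id v))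
      where
      C₂≈id : C 2 f ≈ᴿ f
      C₂≈id u _ = trans (+-cong (trans (*-congˡ (trans (*-congˡ (M-0 u)) (zeroʳ c₀))) (zeroʳ _)) (⁻¹-involutive (f u)))
                        (+-identityˡ (f u))

    Φ-rec : ∀ k f v → Φ (suc (suc k)) f v ≈ natR 2 * (c₀ * M (Φ (suc k) f) v) - Φ k f v
    Φ-rec k f v = begin
      s * M (C (3 ℕ.+ k) f) v - C (2 ℕ.+ k) f v                   ≈⟨ +-congʳ (*-congˡ M-C₃) ⟩
      s * (natR 2 * (c₀ * X) - Y) - (natR 2 * (c₀ * Y) - Z)      ≈⟨ chebyshev-rearrange s (natR 2) c₀ X Y Z ⟩
      natR 2 * (c₀ * (s * X - Y)) - (s * Y - Z)                  ≈⟨ +-congʳ (*-congˡ (*-congˡ M-Φ₁)) ⟨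
      natR 2 * (c₀ * M (Φ (suc k) f) v) - Φ k f v                ∎
      where
      X Y Z : Carrier
      X = M (M (C (2 ℕ.+ k) f)) v
      Y = M (C (suc k) f) v
      Z = C k f v
      M-C₃ : M (C (3 ℕ.+ k) f) v ≈ natR 2 * (c₀ * X) - Y
      M-C₃ = trans (M-- (λ u → natR 2 * (c₀ * M (C (2 ℕ.+ k) f) u)) (C (suc k) f) v)
                   (+-congʳ (trans (M-*ˡ (natR 2) (λ u → c₀ * M (C (2 ℕ.+ k) f) u) v)
                                   (*-congˡ (M-*ˡ c₀ (M (C (2 ℕ.+ k) f)) v))))
      M-Φ₁ : M (Φ (suc k) f) v ≈ s * X - Y
      M-Φ₁ = trans (M-- (λ u → s * M (C (2 ℕ.+ k) f) u) (C (suc k) f) v) (+-congʳ (M-*ˡ s (M (C (2 ℕ.+ k) f)) v))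

    module _ (r : Carrier) where

      Ψ : ℕ → Op q
      Ψ k f v = pow r k * Φ k f v

      Ψ-0 : ∀ f v → Ψ 0 f v ≈ f v
      Ψ-0 f v = trans (*-identityˡ _) (Φ-0 f v)

      Ψ-1 : s * r ≈ 1# → ∀ f v → Ψ 1 f v ≈ M f v
      Ψ-1 s·r≈1 f v = begin
        (r * 1#) * Φ 1 f v  ≈⟨ *-cong (*-identityʳ r) (Φ-1 f v) ⟩
        r * (s * M f v)     ≈⟨ *-assoc _ _ _ ⟨
        (r * s) * M f v     ≈⟨ *-congʳ (trans (*-comm r s) s·r≈1) ⟩
        1# * M f v          ≈⟨ *-identityˡ _ ⟩
        M f v               ∎

      Ψ-rec : natR 2 * c₀ ≈ natR (suc q) * r → ∀ k f → Ψ (suc (suc k)) f ≈ᴿ meanStep M r (Ψ (suc k) f) (Ψ k f)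
      Ψ-rec 2c₀≈[q+1]r k f v _ = begin
        (r * (r * P)) * Φ (suc (suc k)) f v           ≈⟨ *-congˡ (Φ-rec k f v) ⟩
        (r * (r * P)) * (natR 2 * (c₀ * Y) + - Z)
          ≈⟨ solve 6 (λ r P two c y z′ → (r :* (r :* P)) :* (two :* (c :* y) :+ z′)
                                       := (r :* r) :* ((two :* c) :* (P :* y) :+ P :* z′)) refl r P (natR 2) c₀ Y (- Z) ⟩
        (r * r) * ((natR 2 * c₀) * (P * Y) + P * - Z)
          ≈⟨ *-congˡ (+-cong (*-congʳ 2c₀≈[q+1]r) (sym (-‿distribʳ-* P Z))) ⟩
        (r * r) * ((natR (suc q) * r) * (P * Y) - P * Z)
          ≈⟨ *-congˡ (+-congʳ (solve 4 (λ Q r P y → (Q :* r) :* (P :* y) := Q :* ((r :* P) :* y))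
                                      refl (natR (suc q)) r P Y)) ⟩
        (r * r) * (natR (suc q) * ((r * P) * Y) - P * Z)
          ≈⟨ *-congˡ (+-congʳ (*-congˡ (M-*ˡ (r * P) (Φ (suc k) f) v))) ⟨
        (r * r) * (natR (suc q) * M (Ψ (suc k) f) v - Ψ k f v) ∎
        where
        P Y Z : Carrier
        P = pow r k
        Y = M (Φ (suc k) f) v
        Z = Φ k f v

  q·r²≈1 : ∀ q s r → s * s ≈ natR q → s * r ≈ 1# → natR q * (r * r) ≈ 1#
  q·r²≈1 q s r s²≈q s·r≈1 = begin
    natR q * (r * r)   ≈⟨ *-congʳ s²≈q ⟨
    (s * s) * (r * r)  ≈⟨ solve 2 (λ s r → (s :* s) :* (r :* r) := (s :* r) :* (s :* r)) refl s r ⟩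
    (s * r) * (s * r)  ≈⟨ *-cong s·r≈1 s·r≈1 ⟩
    1# * 1#            ≈⟨ *-identityˡ 1# ⟩
    1#                 ∎

  2c₀≈[q+1]r : ∀ q h r → natR 2 * h ≈ 1# → natR 2 * ((natR (suc q) * h) * r) ≈ natR (suc q) * r
  2c₀≈[q+1]r q h r 2h≈1 = begin
    natR 2 * ((natR (suc q) * h) * r) ≈⟨ solve 4 (λ two Q h r → two :* ((Q :* h) :* r) := (two :* h) :* (Q :* r))
                                                 refl (natR 2) (natR (suc q)) h r ⟩
    (natR 2 * h) * (natR (suc q) * r) ≈⟨ *-congʳ 2h≈1 ⟩
    1# * (natR (suc q) * r)           ≈⟨ *-identityˡ _ ⟩
    natR (suc q) * r                  ∎

theorem6p7 : ∀ {c ℓ : Level} (R : CommutativeRing c ℓ) → let open CommutativeRing R in let open Tree R in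
    (q : ℕ) → 1 ≤ q →
    (s sInv h t : Carrier) →
    s * s ≈ natR q → s * sInv ≈ 1# → natR 2 * h ≈ 1# → natR (suc q) * t ≈ 1# →
    (k : ℕ) (f : Fn q) (v : Word q) → T (reduced v) →
    μ q sInv t k f v
      ≈ pow sInv k
        * (s * μ q sInv t 1 (chebU (scaleOp ((natR (suc q) * h) * sInv) (μ q sInv t 1)) (suc k) f) v
           - chebU (scaleOp ((natR (suc q) * h) * sInv) (μ q sInv t 1)) k f v)
theorem6p7 R q _ s sInv h t s²≈q s·sInv≈1 2h≈1 [q+1]t≈1 k f =
  recurrence-unique (≈ᴿ-setoid q) (meanStep μ₁ sInv) (meanStep-cong μ₁ sInv (μ₁-cong q sInv t))
    (λ k → μ q sInv t k f) (λ k → Ψ sInv k f)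
    (λ k → μ-rec q sInv t (q·r²≈1 q s sInv s²≈q s·sInv≈1) [q+1]t≈1 k f)
    (λ k → Ψ-rec sInv (2c₀≈[q+1]r q h sInv 2h≈1) k f)
    (λ v _ → sym (Ψ-0 sInv f v))
    (λ v _ → sym (Ψ-1 sInv s·sInv≈1 f v))
    k
  where
  open CommutativeRing R using (sym; _*_)
  open Tree R using (μ; natR; Op)
  open MeanValues R
  μ₁ : Op q
  μ₁ = μ q sInv t 1
  open Chebyshev μ₁ (μ₁-cong q sInv t) (μ₁-*ˡ q sInv t) (μ₁-- q sInv t) ((natR (suc q) * h) * sInv) s
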